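{- As soon as $\Sigma$ contains at least one unary predicate, there exists a monotone language over $A=2^\Sigma$ that is definable in $\mathrm{FO}$ but not definable in $\mathrm{FO}^+$.
   Context: Let $\Sigma$ be a finite set of unary predicates and $A=2^\Sigma$. For words $u,v\in A^*$, $u\le_{A^*}v$ iff $|u|=|v|$ and each letter of $u$ is a subset of the corresponding letter of $v$; $L$ is monotone if $u\in L$ and $u\le_{A^*}v$ imply $v\in L$. $\mathrm{FO}$ is first-order logic on words with unary atoms $a(x)$ for $a\in\Sigma$ (true iff $a$ belongs to the letter at position $x$) and binary predicates $<,\le,=,\ne,\mathrm{succ},\mathrm{nsucc}$ on positions; $\mathrm{FO}^+$ is its negation-free fragment; a closed formula defines the set of words satisfying it. -}

module Defs where

open import Data.Nat using (ℕ; suc)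
open import Data.Fin using (Fin; toℕ; zero; suc) renaming (_<_ to _<ᶠ_; _≤_ to _≤ᶠ_)
open import Data.Fin.Subset using (Subset; _∈_; _⊆_)
open import Data.List using (List; length; lookup)
open import Data.List.Relation.Binary.Pointwise using (Pointwise)
open import Data.Product using (Σ-syntax; _×_; _,_)
open import Data.Sum using (_⊎_)
open import Data.Unit using (⊤)
open import Data.Empty using (⊥)
open import Function.Bundles using (_⇔_)
open import Relation.Nullary using (¬_)
open import Relation.Binary.PropositionalEquality using (_≡_)

-- The alphabet Σ of unary predicates is Fin k; a letter of A = 2^Σ is a Subset k.
Letter : ℕ → Set
Letter k = Subset k

Word : ℕ → Set
Word k = List (Letter k)

Language : ℕ → Set₁
Language k = Word k → Set

_≤w_ : ∀ {k} → Word k → Word k → Set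
u ≤w v = Pointwise _⊆_ u v

Monotone : ∀ {k} → Language k → Set
Monotone {k} L = ∀ (u v : Word k) → u ≤w v → L u → L v

-- First-order formulas over Σ = Fin k with n free variables (de Bruijn indices).
data Formula (k : ℕ) : ℕ → Set where
  tt ff      : ∀ {n} → Formula k n
  pred       : ∀ {n} → Fin k → Fin n → Formula k n
  lt le eq neq succ nsucc : ∀ {n} → Fin n → Fin n → Formula k n
  _∧_ _∨_    : ∀ {n} → Formula k n → Formula k n → Formula k n
  ¬'_        : ∀ {n} → Formula k n → Formula k n
  ex all     : ∀ {n} → Formula k (suc n) → Formula k n

data Positive {k : ℕ} : ∀ {n} → Formula k n → Set where
  tt    : ∀ {n} → Positive (tt {n = n})
  ff    : ∀ {n} → Positive (ff {n = n})
  pred  : ∀ {n} a (x : Fin n) → Positive (pred a x)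
  lt    : ∀ {n} (x y : Fin n) → Positive (lt x y)
  le    : ∀ {n} (x y : Fin n) → Positive (le x y)
  eq    : ∀ {n} (x y : Fin n) → Positive (eq x y)
  neq   : ∀ {n} (x y : Fin n) → Positive (neq x y)
  succ  : ∀ {n} (x y : Fin n) → Positive (succ x y)
  nsucc : ∀ {n} (x y : Fin n) → Positive (nsucc x y)
  _∧_   : ∀ {n} {φ ψ : Formula k n} → Positive φ → Positive ψ → Positive (φ ∧ ψ)
  _∨_   : ∀ {n} {φ ψ : Formula k n} → Positive φ → Positive ψ → Positive (φ ∨ ψ)
  ex    : ∀ {n} {φ : Formula k (suc n)} → Positive φ → Positive (ex φ)
  all   : ∀ {n} {φ : Formula k (suc n)} → Positive φ → Positive (all φ)

Pos : ∀ {k} → Word k → Set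
Pos w = Fin (length w)

extend : ∀ {k n} (w : Word k) → Pos w → (Fin n → Pos w) → Fin (suc n) → Pos w
extend w p ρ zero    = p
extend w p ρ (suc i) = ρ i

Sat : ∀ {k n} (w : Word k) → (Fin n → Pos w) → Formula k n → Set
Sat w ρ tt          = ⊤
Sat w ρ ff          = ⊥
Sat w ρ (pred a x)  = a ∈ lookup w (ρ x)
Sat w ρ (lt x y)    = ρ x <ᶠ ρ y
Sat w ρ (le x y)    = ρ x ≤ᶠ ρ y
Sat w ρ (eq x y)    = ρ x ≡ ρ y
Sat w ρ (neq x y)   = ¬ (ρ x ≡ ρ y)
Sat w ρ (succ x y)  = toℕ (ρ y) ≡ suc (toℕ (ρ x))
Sat w ρ (nsucc x y) = ¬ (toℕ (ρ y) ≡ suc (toℕ (ρ x)))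
Sat w ρ (φ ∧ ψ)     = Sat w ρ φ × Sat w ρ ψ
Sat w ρ (φ ∨ ψ)     = Sat w ρ φ ⊎ Sat w ρ ψ
Sat w ρ (¬' φ)      = ¬ Sat w ρ φ
Sat w ρ (ex φ)      = Σ[ p ∈ Pos w ] Sat w (extend w p ρ) φ
Sat w ρ (all φ)     = ∀ (p : Pos w) → Sat w (extend w p ρ) φ

Sentence : ℕ → Set
Sentence k = Formula k 0

empty : ∀ {k} (w : Word k) → Fin 0 → Pos w
empty w ()

_⊨_ : ∀ {k} → Word k → Sentence k → Set
w ⊨ φ = Sat w (empty w) φ

FO-definable : ∀ {k} → Language k → Set
FO-definable {k} L = Σ[ φ ∈ Sentence k ] (∀ (w : Word k) → L w ⇔ (w ⊨ φ))

FO⁺-definable : ∀ {k} → Language k → Set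
FO⁺-definable {k} L =
  Σ[ φ ∈ Sentence k ] (Positive φ × (∀ (w : Word k) → L w ⇔ (w ⊨ φ)))

-- Let a be the first unary predicate and read a word as its sequence of a-bits. The language
-- ThreeOnesOrClass consists of the words with a factor 111 or with a residue class mod 3 on which all
-- bits are 1; it is monotone by construction.
--
-- In a 111-free word consecutive zeros are 1, 2 or 3 apart, so the residue class of the zeros changes
-- only at gaps of length 1 and 2, and the zeros meet all three classes exactly when two gaps of equal
-- length 1 or 2 are separated by gaps of length 3 only. A run of gaps of length 3 is first-order as
-- "every zero is preceded by 11", which yields the sentence φ.
--
-- It is not FO⁺: u = (100)ⁿ is in the language, whereas the word v of length 3n + 1 whose zeros are
-- position 1, position 3n and the class 2 is not. The letter of u at x is included in the letter of v
-- at x when x + 1 < 3n, and at x + 1 when x ≥ 1. Duplicator keeps the pebbles left of a free window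
-- [l , r) in place and moves those right of it one step; a window of width 2w + 1 leaves one of width w
-- after any move, so for large n every positive sentence of depth j true in u is true in v.
module Submission where

open import Defs

open import Data.Bool using (Bool; true; false; not) renaming (_≟_ to _≟ᵇ_)
open import Data.Empty using (⊥; ⊥-elim)
open import Data.Fin using (Fin; toℕ; fromℕ<; #_) renaming (zero to fzero; suc to fsuc; _≤_ to _≤ᶠ_; _<_ to _<ᶠ_)
open import Data.Fin.Properties using (toℕ<n; toℕ-fromℕ<)
import Data.Fin.Properties as Fin
open import Data.Fin.Subset using (_∈_; _∉_; _⊆_) renaming (⊤ to full; ⊥ to ∅)
open import Data.Fin.Subset.Properties using (_∈?_; ∈⊤; ∉⊥)
open import Data.List using (List; []; _∷_; length; lookup; applyUpTo)
open import Data.List.Properties using (length-applyUpTo; lookup-applyUpTo)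
open import Data.List.Relation.Binary.Pointwise using (_∷_)
open import Data.List.Relation.Binary.Pointwise.Properties using (Pointwise-length)
open import Data.Nat using (ℕ; zero; suc; _+_; _∸_; _*_; _⊔_; _⊓_; _≤_; _<_; z≤n; s≤s; s≤s⁻¹; _≤?_; _<?_)
open import Data.Nat.Properties using
  ( _≟_; ≤-refl; ≤-reflexive; ≤-trans; <-trans; ≤-<-trans; <-≤-trans; <⇒≤; <⇒≱; ≰⇒>; ≮⇒≥; ≤-pred
  ; n<1+n; n≤1+n; m<n⇒m<1+n; m≤n⇒m≤1+n; m<1+n⇒m<n∨m≡n; m≤n⇒m<n∨m≡n; suc-injective
  ; m≤m+n; m≤n+m; m<m+n; m≤m*n; m∸n+n≡m; +-assoc; +-suc; +-monoʳ-≤; +-monoˡ-<; +-cancelʳ-≤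
  ; m≤m⊔n; m≤n⊔m; ⊔-lub; m⊔n≤o⇒m≤o; m⊔n≤o⇒n≤o; +-distribʳ-⊔; m⊓n≤m; m⊓n≤n; ⊓-glb
  ; anyUpTo?; module ≤-Reasoning )
open import Data.Product using (Σ; Σ-syntax; _×_; _,_; proj₁; proj₂)
open import Data.Sum using (_⊎_; inj₁; inj₂; map₁)
open import Data.Sum.Function.Propositional using (_⊎-⇔_)
open import Function using (_∘_; case_of_; _⇔_; mk⇔; Equivalence)
open import Function.Properties.Equivalence using () renaming (sym to ⇔-sym; trans to ⇔-trans)
open import Relation.Binary.PropositionalEquality using (_≡_; _≢_; refl; sym; trans; cong; subst; subst₂)
open import Relation.Nullary using (¬_; Dec; yes; no; contraposition)
open import Relation.Nullary.Decidable using (does; dec-true; dec-false; _×-dec_)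

data Residue : Set where
  r₀ r₁ r₂ : Residue

next : Residue → Residue
next r₀ = r₁
next r₁ = r₂
next r₂ = r₀

residue : ℕ → Residue
residue zero    = r₀
residue (suc n) = next (residue n)

next³ : ∀ r → next (next (next r)) ≡ r
next³ r₀ = refl
next³ r₁ = refl
next³ r₂ = refl

data Gap : Set where
  gap₁ gap₂ : Gap

advance : Gap → Residue → Residue
advance gap₁ r = next r
advance gap₂ r = next (next r)

advance≢ : ∀ g r → r ≢ advance g r
advance≢ gap₁ r₀ ()
advance≢ gap₁ r₁ ()
advance≢ gap₁ r₂ ()
advance≢ gap₂ r₀ ()
advance≢ gap₂ r₁ ()
advance≢ gap₂ r₂ ()

advance²≢ : ∀ g r → r ≢ advance g (advance g r)
advance²≢ gap₁ r₀ ()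
advance²≢ gap₁ r₁ ()
advance²≢ gap₁ r₂ ()
advance²≢ gap₂ r₀ ()
advance²≢ gap₂ r₁ ()
advance²≢ gap₂ r₂ ()

advance-swap : ∀ {g g'} → g ≢ g' → ∀ r → advance g' (advance g' r) ≡ advance g r
advance-swap {gap₁} {gap₁} g≢g' r = ⊥-elim (g≢g' refl)
advance-swap {gap₁} {gap₂} _ r = next³ (next r)
advance-swap {gap₂} {gap₁} _ r = refl
advance-swap {gap₂} {gap₂} g≢g' r = ⊥-elim (g≢g' refl)

next-orbit : ∀ r s → s ≡ r ⊎ s ≡ next r ⊎ s ≡ next (next r)
next-orbit r₀ r₀ = inj₁ refl
next-orbit r₀ r₁ = inj₂ (inj₁ refl)
next-orbit r₀ r₂ = inj₂ (inj₂ refl)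
next-orbit r₁ r₀ = inj₂ (inj₂ refl)
next-orbit r₁ r₁ = inj₁ refl
next-orbit r₁ r₂ = inj₂ (inj₁ refl)
next-orbit r₂ r₀ = inj₂ (inj₁ refl)
next-orbit r₂ r₁ = inj₂ (inj₂ refl)
next-orbit r₂ r₂ = inj₁ refl

advance-orbit : ∀ g r s → s ≡ r ⊎ s ≡ advance g r ⊎ s ≡ advance g (advance g r)
advance-orbit gap₁ r s = next-orbit r s
advance-orbit gap₂ r s with next-orbit r s
... | inj₁ s≡r              = inj₁ s≡r
... | inj₂ (inj₁ s≡r+1)     = inj₂ (inj₂ (trans s≡r+1 (sym (next³ (next r)))))
... | inj₂ (inj₂ s≡r+2)     = inj₂ (inj₁ s≡r+2)

_≟ᵍ_ : (g g' : Gap) → Dec (g ≡ g')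
gap₁ ≟ᵍ gap₁ = yes refl
gap₁ ≟ᵍ gap₂ = no λ ()
gap₂ ≟ᵍ gap₁ = no λ ()
gap₂ ≟ᵍ gap₂ = yes refl

below-suc : ∀ {N} {P : ℕ → Set} → (∀ x → x < N → P x) → P N → ∀ x → x < suc N → P x
below-suc below at x x<1+N with m<1+n⇒m<n∨m≡n x<1+N
... | inj₁ x<N  = below x x<N
... | inj₂ refl = at

bit-clash : ∀ {b : Bool} → b ≡ true → b ≡ false → ⊥
bit-clash refl ()

module Bits (b : ℕ → Bool) where

  ThreeOnes : Set
  ThreeOnes = Σ[ x ∈ ℕ ] (b x ≡ true × b (suc x) ≡ true × b (suc (suc x)) ≡ true)

  OnesOn : ℕ → Residue → Set
  OnesOn N r = ∀ x → x < N → residue x ≡ r → b x ≡ true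

  Avoids : ℕ → Residue → Set
  Avoids N r = ∀ x → x < N → b x ≡ false → residue x ≢ r

  ZerosIn : ℕ → Residue → Set
  ZerosIn N r = ∀ x → x < N → b x ≡ false → residue x ≡ r

  onesOn⇒avoids : ∀ {N r} → OnesOn N r → Avoids N r
  onesOn⇒avoids ones x x<N bx rx≡r = bit-clash (ones x x<N rx≡r) bx

  avoids⇒onesOn : ∀ {N r} → Avoids N r → OnesOn N r
  avoids⇒onesOn avoids x x<N rx≡r with b x in bx
  ... | true  = refl
  ... | false = ⊥-elim (avoids x x<N bx rx≡r)

  zerosIn⇒avoids : ∀ {N r s} → r ≢ s → ZerosIn N r → Avoids N s
  zerosIn⇒avoids r≢s zeros x x<N bx rx≡s = r≢s (trans (sym (zeros x x<N bx)) rx≡s)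

  Chain : ℕ → ℕ → Set
  Chain z y = ∀ x → z < x → x ≤ y → b x ≡ false →
    Σ[ m ∈ ℕ ] (x ≡ suc (suc m) × b (suc m) ≡ true × b m ≡ true)

  chain-refl : ∀ {z} → Chain z z
  chain-refl x z<x x≤z _ = ⊥-elim (<⇒≱ z<x x≤z)

  chain-≤ : ∀ {z y y'} → y' ≤ y → Chain z y → Chain z y'
  chain-≤ y'≤y chain x z<x x≤y' = chain x z<x (≤-trans x≤y' y'≤y)

  chain-three : ∀ {z ℓ} → Chain z ℓ → (∀ x → ℓ < x → x < suc (suc (suc ℓ)) → b x ≡ true) →
                Chain z (suc (suc (suc ℓ)))
  chain-three {ℓ = ℓ} chain ones x z<x x≤ℓ+3 bx with m≤n⇒m<n∨m≡n x≤ℓ+3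
  ... | inj₂ refl = suc ℓ , refl , ones _ (m<n⇒m<1+n (n<1+n ℓ)) (n<1+n _) , ones _ (n<1+n ℓ) (m<n⇒m<1+n (n<1+n _))
  ... | inj₁ x<ℓ+3 with x ≤? ℓ
  ...   | yes x≤ℓ = chain x z<x x≤ℓ bx
  ...   | no x≰ℓ  = ⊥-elim (bit-clash (ones x (≰⇒> x≰ℓ) x<ℓ+3) bx)

  -- A chain of zeros three apart stays in one residue class: no 111 forces the zero before each link.
  chain-residue : ¬ ThreeOnes → ∀ d {z} → Chain z (d + z) → b z ≡ false → b (d + z) ≡ false →
                  residue (d + z) ≡ residue z
  chain-residue _ zero _ _ _ = refl
  chain-residue no111 (suc zero) chain bz bx with chain _ (n<1+n _) ≤-refl bx
  ... | _ , refl , b1 , _ = ⊥-elim (bit-clash b1 bz)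
  chain-residue no111 (suc (suc zero)) chain bz bx with chain _ (m<n⇒m<1+n (n<1+n _)) ≤-refl bx
  ... | _ , refl , _ , b0 = ⊥-elim (bit-clash b0 bz)
  chain-residue no111 (suc (suc (suc d))) {z} chain bz bx with chain _ (s≤s (m≤n+m z (suc (suc d)))) ≤-refl bx
  ... | _ , refl , b2 , b1 with b (d + z) in b0
  ...   | true  = ⊥-elim (no111 (d + z , b0 , b1 , b2))
  ...   | false = trans (next³ _) (chain-residue no111 d (chain-≤ (m≤n+m _ 3) chain) bz b0)

  chain-residue′ : ¬ ThreeOnes → ∀ {z y} → z ≤ y → Chain z y → b z ≡ false → b y ≡ false →
                   residue y ≡ residue z
  chain-residue′ no111 {z} {y} z≤y with y ∸ z | m∸n+n≡m z≤y
  ... | d | refl = chain-residue no111 d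

  Hop : Gap → ℕ → ℕ → Set
  Hop gap₁ p z = z ≡ suc p
  Hop gap₂ p z = z ≡ suc (suc p) × b (suc p) ≡ true

  hop-< : ∀ g {p z} → Hop g p z → p < z
  hop-< gap₁ refl       = n<1+n _
  hop-< gap₂ (refl , _) = m<n⇒m<1+n (n<1+n _)

  hop-residue : ∀ g {p z} → Hop g p z → residue z ≡ advance g (residue p)
  hop-residue gap₁ refl       = refl
  hop-residue gap₂ (refl , _) = refl

  EqualHops : ℕ → ℕ → ℕ → ℕ → Set
  EqualHops z₁ z₂ z₃ z₄ = Σ[ g ∈ Gap ] (Hop g z₁ z₂ × Hop g z₃ z₄)

  -- Two hops of the same length joined by a chain: the zeros z₁ , z₂ , z₄ lie in three distinct residue classes.
  record Configuration (N : ℕ) : Set where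
    constructor configuration
    field
      z₁ z₂ z₃ z₄ : ℕ
      off₁ : b z₁ ≡ false
      off₂ : b z₂ ≡ false
      off₃ : b z₃ ≡ false
      off₄ : b z₄ ≡ false
      z₂≤z₃ : z₂ ≤ z₃
      chain : Chain z₂ z₃
      hops : EqualHops z₁ z₂ z₃ z₄
      z₄<N : z₄ < N

  configuration-bounds : ∀ {N} (c : Configuration N) → let open Configuration c in
    z₁ < N × z₂ < N × z₃ < N
  configuration-bounds {N} (configuration z₁ z₂ z₃ _ _ _ _ _ z₂≤z₃ _ (g , first , last) z₄<N) =
    <-trans (hop-< g first) z₂<N , z₂<N , z₃<N
    where
      z₃<N : z₃ < N
      z₃<N = <-trans (hop-< g last) z₄<N
      z₂<N : z₂ < N
      z₂<N = ≤-<-trans z₂≤z₃ z₃<N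

  configuration⇒¬onesOn : ¬ ThreeOnes → ∀ {N r} → Configuration N → ¬ OnesOn N r
  configuration⇒¬onesOn no111 {r = r} c@(configuration z₁ z₂ z₃ z₄ off₁ off₂ off₃ off₄ z₂≤z₃ chain (g , first , last) z₄<N) ones
    with configuration-bounds c
  ... | z₁<N , z₂<N , _ = excluded (advance-orbit g (residue z₁) r)
    where
      residue₄ : residue z₄ ≡ advance g (advance g (residue z₁))
      residue₄ = trans (hop-residue g last)
        (cong (advance g) (trans (chain-residue′ no111 z₂≤z₃ chain off₂ off₃) (hop-residue g first)))

      excluded : r ≡ residue z₁ ⊎ r ≡ advance g (residue z₁) ⊎ r ≡ advance g (advance g (residue z₁)) → ⊥
      excluded (inj₁ e)        = onesOn⇒avoids ones z₁ z₁<N off₁ (sym e)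
      excluded (inj₂ (inj₁ e)) = onesOn⇒avoids ones z₂ z₂<N off₂ (trans (hop-residue g first) (sym e))
      excluded (inj₂ (inj₂ e)) = onesOn⇒avoids ones z₄ z₄<N off₄ (trans residue₄ (sym e))

  LastZero : ℕ → ℕ → Set
  LastZero N ℓ = ℓ < N × b ℓ ≡ false × (∀ x → ℓ < x → x < N → b x ≡ true)

  last-zero-one : ∀ {N ℓ} → b N ≡ true → LastZero N ℓ → LastZero (suc N) ℓ
  last-zero-one bN (ℓ<N , bℓ , ones) =
    m<n⇒m<1+n ℓ<N , bℓ , λ x ℓ<x x<1+N → below-suc (λ y y<N ℓ<y → ones y ℓ<y y<N) (λ _ → bN) x x<1+N ℓ<x

  last-zero-new : ∀ {N} → b N ≡ false → LastZero (suc N) N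
  last-zero-new bN = n<1+n _ , bN , λ x N<x x<1+N → ⊥-elim (<⇒≱ N<x (≤-pred x<1+N))

  data NextZero (ℓ : ℕ) : ℕ → Set where
    hop   : ∀ g {z} → Hop g ℓ z → NextZero ℓ z
    three : NextZero ℓ (suc (suc (suc ℓ)))

  next-zero-after-ones : ¬ ThreeOnes → ∀ {ℓ} d → (∀ k → k < d → b (k + suc ℓ) ≡ true) → NextZero ℓ (d + suc ℓ)
  next-zero-after-ones _ zero _ = hop gap₁ refl
  next-zero-after-ones _ (suc zero) ones = hop gap₂ (refl , ones 0 (s≤s z≤n))
  next-zero-after-ones _ (suc (suc zero)) _ = three
  next-zero-after-ones no111 {ℓ} (suc (suc (suc d))) ones =
    ⊥-elim (no111 (suc ℓ , ones 0 (s≤s z≤n) , ones 1 (s≤s (s≤s z≤n)) , ones 2 (s≤s (s≤s (s≤s z≤n)))))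

  next-zero : ¬ ThreeOnes → ∀ {N ℓ} → LastZero N ℓ → NextZero ℓ N
  next-zero no111 {N} {ℓ} (ℓ<N , _ , ones) with N ∸ suc ℓ | m∸n+n≡m ℓ<N
  ... | d | refl = next-zero-after-ones no111 d λ k k<d → ones (k + suc ℓ) (m≤n+m (suc ℓ) k) (+-monoˡ-< (suc ℓ) k<d)

  -- The state after scanning the first N bits of a 111-free sequence; all states but found exhibit a
  -- residue class without zeros.
  data Scan (N : ℕ) : Set where
    no-zero      : (∀ x → x < N → b x ≡ true) → Scan N
    one-residue  : ∀ {ℓ} → LastZero N ℓ → ZerosIn N (residue ℓ) → Scan N
    two-residues : ∀ {p z ℓ} g → Hop g p z → b p ≡ false → b z ≡ false → z ≤ ℓ → Chain z ℓ →
                   LastZero N ℓ → Avoids N (advance g (residue ℓ)) → Scan N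
    found        : Configuration N → Scan N

  configuration-suc : ∀ {N} → Configuration N → Configuration (suc N)
  configuration-suc c = record { Configuration c hiding (z₄<N) ; z₄<N = m<n⇒m<1+n (Configuration.z₄<N c) }

  scan-one : ∀ {N} → b N ≡ true → Scan N → Scan (suc N)
  scan-one bN (no-zero ones) = no-zero (below-suc ones bN)
  scan-one bN (one-residue last zeros) =
    one-residue (last-zero-one bN last) (below-suc zeros λ bN≡false → ⊥-elim (bit-clash bN bN≡false))
  scan-one bN (two-residues g h bp bz z≤ℓ chain last avoids) =
    two-residues g h bp bz z≤ℓ chain (last-zero-one bN last) (below-suc avoids λ bN≡false → ⊥-elim (bit-clash bN bN≡false))
  scan-one bN (found c) = found (configuration-suc c)

  avoids-after-hop : ∀ {g ℓ N} → Hop g ℓ N → Avoids N (advance g (advance g (residue ℓ))) →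
                     Avoids (suc N) (advance g (residue N))
  avoids-after-hop {g} h avoids =
    subst (Avoids _) (cong (advance g) (sym (hop-residue g h)))
      (below-suc avoids λ _ → subst (_≢ _) (sym (hop-residue g h)) (advance≢ g _))

  scan-zero : ¬ ThreeOnes → ∀ {N} → b N ≡ false → Scan N → Scan (suc N)
  scan-zero _ bN (no-zero ones) =
    one-residue (last-zero-new bN) (below-suc (λ x x<N bx → ⊥-elim (bit-clash (ones x x<N) bx)) λ _ → refl)
  scan-zero no111 bN (one-residue last zeros) with next-zero no111 last
  ... | hop g h = two-residues g h (proj₁ (proj₂ last)) bN ≤-refl chain-refl (last-zero-new bN)
          (avoids-after-hop h (zerosIn⇒avoids (advance²≢ g _) zeros))
  ... | three = one-residue (last-zero-new bN)
          (below-suc (λ x x<N bx → trans (zeros x x<N bx) (sym (next³ _))) λ _ → refl)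
  scan-zero no111 bN (two-residues g h bp bz z≤ℓ chain last avoids) with next-zero no111 last
  ... | three = two-residues g h bp bz (≤-trans z≤ℓ (m≤n+m _ 3)) (chain-three chain (proj₂ (proj₂ last)))
          (last-zero-new bN)
          (below-suc (λ x x<N bx → subst (λ r → residue x ≢ advance g r) (sym (next³ _)) (avoids x x<N bx))
                     (λ _ → advance≢ g _))
  ... | hop g' h' with g ≟ᵍ g'
  ...   | yes refl = found (record
          { z₁ = _ ; z₂ = _ ; z₃ = _ ; z₄ = _ ; off₁ = bp ; off₂ = bz ; off₃ = proj₁ (proj₂ last) ; off₄ = bN
          ; z₂≤z₃ = z≤ℓ ; chain = chain ; hops = g , h , h' ; z₄<N = n<1+n _ })
  ...   | no g≢g' = two-residues g' h' (proj₁ (proj₂ last)) bN ≤-refl chain-refl (last-zero-new bN)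
          (avoids-after-hop h' (subst (Avoids _) (sym (advance-swap g≢g' _)) avoids))
  scan-zero _ _ (found c) = found (configuration-suc c)

  scan : ¬ ThreeOnes → ∀ N → Scan N
  scan _ zero = no-zero λ _ ()
  scan no111 (suc N) with b N in bN
  ... | true  = scan-one bN (scan no111 N)
  ... | false = scan-zero no111 bN (scan no111 N)

  scan-result : ∀ {N} → Scan N → Configuration N ⊎ Σ Residue (OnesOn N)
  scan-result (no-zero ones) = inj₂ (r₀ , λ x x<N _ → ones x x<N)
  scan-result (one-residue _ zeros) = inj₂ (_ , avoids⇒onesOn (zerosIn⇒avoids (advance≢ gap₁ _) zeros))
  scan-result (two-residues _ _ _ _ _ _ _ avoids) = inj₂ (_ , avoids⇒onesOn avoids)
  scan-result (found c) = inj₁ c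

  configuration-or-onesOn : ¬ ThreeOnes → ∀ N → Configuration N ⊎ Σ Residue (OnesOn N)
  configuration-or-onesOn no111 N = scan-result (scan no111 N)

  configuration-free⇔onesOn : Dec ThreeOnes → ∀ N →
    (ThreeOnes ⊎ ¬ Configuration N) ⇔ (ThreeOnes ⊎ Σ Residue (OnesOn N))
  configuration-free⇔onesOn three? N = mk⇔ to from
    where
      to : ThreeOnes ⊎ ¬ Configuration N → ThreeOnes ⊎ Σ Residue (OnesOn N)
      to (inj₁ t) = inj₁ t
      to (inj₂ no-conf) = case three? of λ where
        (yes t)     → inj₁ t
        (no no111) → map₁ (⊥-elim ∘ no-conf) (configuration-or-onesOn no111 N)

      from : ThreeOnes ⊎ Σ Residue (OnesOn N) → ThreeOnes ⊎ ¬ Configuration N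
      from (inj₁ t) = inj₁ t
      from (inj₂ (_ , ones)) = case three? of λ where
        (yes t)     → inj₁ t
        (no no111) → inj₂ λ c → configuration⇒¬onesOn no111 c ones

-- The language and its first-order definition

position : ∀ {A : Set} {xs : List A} {x} → x < length xs → Σ[ p ∈ Fin (length xs) ] toℕ p ≡ x
position x<n = fromℕ< x<n , toℕ-fromℕ< x<n

-- Beyond the end of the word, bit is false.
bit : ∀ {k} → Word (suc k) → ℕ → Bool
bit []      _       = false
bit (a ∷ _) zero    = does (fzero ∈? a)
bit (_ ∷ w) (suc x) = bit w x

module _ {k : ℕ} where

  bit-lookup : ∀ (w : Word (suc k)) p → bit w (toℕ p) ≡ does (fzero ∈? lookup w p)
  bit-lookup (_ ∷ _) fzero    = refl
  bit-lookup (_ ∷ w) (fsuc p) = bit-lookup w p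

  ∈⇒bit : ∀ (w : Word (suc k)) p → fzero ∈ lookup w p → bit w (toℕ p) ≡ true
  ∈⇒bit w p a∈ = trans (bit-lookup w p) (dec-true (fzero ∈? _) a∈)

  ∉⇒bit : ∀ (w : Word (suc k)) p → fzero ∉ lookup w p → bit w (toℕ p) ≡ false
  ∉⇒bit w p a∉ = trans (bit-lookup w p) (dec-false (fzero ∈? _) a∉)

  bit⇒∈ : ∀ (w : Word (suc k)) p → bit w (toℕ p) ≡ true → fzero ∈ lookup w p
  bit⇒∈ w p one with fzero ∈? lookup w p | bit-lookup w p
  ... | yes a∈ | _   = a∈
  ... | no _   | off = ⊥-elim (bit-clash one off)

  bit⇒∉ : ∀ (w : Word (suc k)) p → bit w (toℕ p) ≡ false → fzero ∉ lookup w p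
  bit⇒∉ w p off a∈ = bit-clash (∈⇒bit w p a∈) off

  bit⇒< : ∀ (w : Word (suc k)) x → bit w x ≡ true → x < length w
  bit⇒< (_ ∷ _) zero    _   = s≤s z≤n
  bit⇒< (_ ∷ w) (suc x) one = s≤s (bit⇒< w x one)

  bit-mono : ∀ {u v : Word (suc k)} → u ≤w v → ∀ x → bit u x ≡ true → bit v x ≡ true
  bit-mono {a ∷ u} {b ∷ v} (a⊆b ∷ _) zero one = ∈⇒bit (b ∷ v) fzero (a⊆b (bit⇒∈ (a ∷ u) fzero one))
  bit-mono (_ ∷ u≤v) (suc x) = bit-mono u≤v x

  threeOnes? : ∀ (w : Word (suc k)) → Dec (Bits.ThreeOnes (bit w))
  threeOnes? w with anyUpTo? (λ x → (bit w x ≟ᵇ true) ×-dec (bit w (suc x) ≟ᵇ true) ×-dec (bit w (suc (suc x)) ≟ᵇ true)) (length w)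
  ... | yes (x , _ , ones) = yes (x , ones)
  ... | no none            = no λ (x , ones) → none (x , bit⇒< w x (proj₁ ones) , ones)

ThreeOnesOrClass : ∀ {k} → Language (suc k)
ThreeOnesOrClass w = ThreeOnes ⊎ Σ Residue (OnesOn (length w))
  where open Bits (bit w)

ThreeOnesOrClass-monotone : ∀ {k} → Monotone (ThreeOnesOrClass {k})
ThreeOnesOrClass-monotone u v u≤v (inj₁ (x , one₀ , one₁ , one₂)) =
  inj₁ (x , bit-mono u≤v x one₀ , bit-mono u≤v _ one₁ , bit-mono u≤v _ one₂)
ThreeOnesOrClass-monotone u v u≤v (inj₂ (r , ones)) =
  inj₂ (r , λ x x<n r≡ → bit-mono u≤v x (ones x (subst (x <_) (sym (Pointwise-length u≤v)) x<n) r≡))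

module _ {k : ℕ} where

  one-at : ∀ (w : Word (suc k)) x → bit w x ≡ true → Σ[ p ∈ Pos w ] (toℕ p ≡ x × fzero ∈ lookup w p)
  one-at w x one with position {xs = w} (bit⇒< w x one)
  ... | p , p≡x = p , p≡x , bit⇒∈ w p (subst (λ m → bit w m ≡ true) (sym p≡x) one)

  one : ∀ {n} → Fin n → Formula (suc k) n
  one x = pred fzero x

  off : ∀ {n} → Fin n → Formula (suc k) n
  off x = ¬' one x

  threeOnesF : Sentence (suc k)
  threeOnesF = ex (ex (ex (succ (# 2) (# 1) ∧ (succ (# 1) (# 0) ∧ (one (# 2) ∧ (one (# 1) ∧ one (# 0)))))))

  chainF : ∀ {n} → Fin n → Fin n → Formula (suc k) n
  chainF z y = all (le (# 0) (fsuc z) ∨ (lt (fsuc y) (# 0) ∨ (one (# 0) ∨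
    ex (ex (succ (# 0) (# 1) ∧ (succ (# 1) (# 2) ∧ (one (# 1) ∧ one (# 0))))))))

  hop₂F : ∀ {n} → Fin n → Fin n → Formula (suc k) n
  hop₂F x y = ex (succ (fsuc x) (# 0) ∧ (succ (# 0) (fsuc y) ∧ one (# 0)))

  hopsF : ∀ {n} → Fin n → Fin n → Fin n → Fin n → Formula (suc k) n
  hopsF z₁ z₂ z₃ z₄ = (succ z₁ z₂ ∧ succ z₃ z₄) ∨ (hop₂F z₁ z₂ ∧ hop₂F z₃ z₄)

  configurationF : Sentence (suc k)
  configurationF = ex (ex (ex (ex (off (# 3) ∧ (off (# 2) ∧ (off (# 1) ∧ (off (# 0) ∧
    (le (# 2) (# 1) ∧ (chainF (# 2) (# 1) ∧ hopsF (# 3) (# 2) (# 1) (# 0))))))))))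

  φ : Sentence (suc k)
  φ = threeOnesF ∨ (¬' configurationF)

  module _ (w : Word (suc k)) where
    open Bits (bit w)

    sat-threeOnes : w ⊨ threeOnesF ⇔ ThreeOnes
    sat-threeOnes = mk⇔ to from
      where
        to : w ⊨ threeOnesF → ThreeOnes
        to (p , q , r , q≡ , r≡ , one₀ , one₁ , one₂) =
          toℕ p , ∈⇒bit w p one₀ , subst (λ x → bit w x ≡ true) q≡ (∈⇒bit w q one₁) ,
          subst (λ x → bit w x ≡ true) (trans r≡ (cong suc q≡)) (∈⇒bit w r one₂)

        from : ThreeOnes → w ⊨ threeOnesF
        from (x , one₀ , one₁ , one₂) with one-at w x one₀ | one-at w (suc x) one₁ | one-at w (suc (suc x)) one₂
        ... | p , p≡ , a | q , q≡ , b | r , r≡ , c =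
          p , q , r , trans q≡ (cong suc (sym p≡)) , trans r≡ (cong suc (sym q≡)) , a , b , c

    module _ {n} (ρ : Fin n → Pos w) where

      sat-hop₂ : ∀ x y → Sat w ρ (hop₂F x y) ⇔ Hop gap₂ (toℕ (ρ x)) (toℕ (ρ y))
      sat-hop₂ x y = mk⇔
        (λ (a , a≡ , y≡ , one₁) → trans y≡ (cong suc a≡) , subst (λ m → bit w m ≡ true) a≡ (∈⇒bit w a one₁))
        (λ (y≡ , one₁) → case one-at w (suc (toℕ (ρ x))) one₁ of λ (a , a≡ , one-a) → a , a≡ , trans y≡ (cong suc (sym a≡)) , one-a)

      sat-hops : ∀ z₁ z₂ z₃ z₄ → Sat w ρ (hopsF z₁ z₂ z₃ z₄) ⇔ EqualHops (toℕ (ρ z₁)) (toℕ (ρ z₂)) (toℕ (ρ z₃)) (toℕ (ρ z₄))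
      sat-hops z₁ z₂ z₃ z₄ = mk⇔ to from
        where
          to : Sat w ρ (hopsF z₁ z₂ z₃ z₄) → EqualHops (toℕ (ρ z₁)) (toℕ (ρ z₂)) (toℕ (ρ z₃)) (toℕ (ρ z₄))
          to (inj₁ hops)       = gap₁ , hops
          to (inj₂ (h₁ , h₂)) = gap₂ , Equivalence.to (sat-hop₂ z₁ z₂) h₁ , Equivalence.to (sat-hop₂ z₃ z₄) h₂

          from : EqualHops (toℕ (ρ z₁)) (toℕ (ρ z₂)) (toℕ (ρ z₃)) (toℕ (ρ z₄)) → Sat w ρ (hopsF z₁ z₂ z₃ z₄)
          from (gap₁ , hops)    = inj₁ hops
          from (gap₂ , h₁ , h₂) = inj₂ (Equivalence.from (sat-hop₂ z₁ z₂) h₁ , Equivalence.from (sat-hop₂ z₃ z₄) h₂)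

      sat-chain : ∀ z y → Sat w ρ (chainF z y) ⇔ Chain (toℕ (ρ z)) (toℕ (ρ y))
      sat-chain z y = mk⇔ to from
        where
          to : Sat w ρ (chainF z y) → Chain (toℕ (ρ z)) (toℕ (ρ y))
          to sat x z<x x≤y bx with position {xs = w} (≤-<-trans x≤y (toℕ<n (ρ y)))
          ... | q , refl with sat q
          ...   | inj₁ x≤z                = ⊥-elim (<⇒≱ z<x x≤z)
          ...   | inj₂ (inj₁ y<x)         = ⊥-elim (<⇒≱ y<x x≤y)
          ...   | inj₂ (inj₂ (inj₁ one₀)) = ⊥-elim (bit⇒∉ w q bx one₀)
          ...   | inj₂ (inj₂ (inj₂ (m₁ , m₂ , m₁≡ , x≡ , one₁ , one₂))) =
            toℕ m₂ , trans x≡ (cong suc m₁≡) , subst (λ m → bit w m ≡ true) m₁≡ (∈⇒bit w m₁ one₁) , ∈⇒bit w m₂ one₂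

          from : Chain (toℕ (ρ z)) (toℕ (ρ y)) → Sat w ρ (chainF z y)
          from chain q with toℕ q ≤? toℕ (ρ z) | toℕ (ρ y) <? toℕ q | bit w (toℕ q) in bq
          ... | yes q≤z | _       | _     = inj₁ q≤z
          ... | no _    | yes y<q | _     = inj₂ (inj₁ y<q)
          ... | no _    | no _    | true  = inj₂ (inj₂ (inj₁ (bit⇒∈ w q bq)))
          ... | no q≰z  | no q≮y  | false with chain (toℕ q) (≰⇒> q≰z) (≮⇒≥ q≮y) bq
          ...   | m , q≡ , one₁ , one₀ with one-at w (suc m) one₁ | one-at w m one₀
          ...     | m₁ , m₁≡ , a | m₂ , m₂≡ , b =
            inj₂ (inj₂ (inj₂ (m₁ , m₂ , trans m₁≡ (cong suc (sym m₂≡)) , trans q≡ (cong suc (sym m₁≡)) , a , b)))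

    sat-configuration : w ⊨ configurationF ⇔ Configuration (length w)
    sat-configuration = mk⇔ to from
      where
        to : w ⊨ configurationF → Configuration (length w)
        to (p₁ , p₂ , p₃ , p₄ , off₁ , off₂ , off₃ , off₄ , z₂≤z₃ , chain , hops) =
          configuration _ _ _ _ (∉⇒bit w p₁ off₁) (∉⇒bit w p₂ off₂) (∉⇒bit w p₃ off₃) (∉⇒bit w p₄ off₄) z₂≤z₃
            (Equivalence.to (sat-chain ρ (# 2) (# 1)) chain) (Equivalence.to (sat-hops ρ (# 3) (# 2) (# 1) (# 0)) hops)
            (toℕ<n p₄)
          where
            ρ : Fin 4 → Pos w
            ρ = extend w p₄ (extend w p₃ (extend w p₂ (extend w p₁ (empty w))))

        from : Configuration (length w) → w ⊨ configurationF
        from c@(configuration z₁ z₂ z₃ z₄ off₁ off₂ off₃ off₄ z₂≤z₃ chain hops z₄<N)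
          with configuration-bounds c
        ... | z₁<N , z₂<N , z₃<N with position {xs = w} z₁<N | position {xs = w} z₂<N | position {xs = w} z₃<N | position {xs = w} z₄<N
        ... | p₁ , refl | p₂ , refl | p₃ , refl | p₄ , refl =
          p₁ , p₂ , p₃ , p₄ , bit⇒∉ w p₁ off₁ , bit⇒∉ w p₂ off₂ , bit⇒∉ w p₃ off₃ , bit⇒∉ w p₄ off₄ , z₂≤z₃ ,
          Equivalence.from (sat-chain ρ (# 2) (# 1)) chain , Equivalence.from (sat-hops ρ (# 3) (# 2) (# 1) (# 0)) hops
          where
            ρ : Fin 4 → Pos w
            ρ = extend w p₄ (extend w p₃ (extend w p₂ (extend w p₁ (empty w))))

¬-cong-⇔ : ∀ {A B : Set} → A ⇔ B → (¬ A) ⇔ (¬ B)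
¬-cong-⇔ A⇔B = mk⇔ (contraposition (Equivalence.from A⇔B)) (contraposition (Equivalence.to A⇔B))

ThreeOnesOrClass⇔φ : ∀ {k} (w : Word (suc k)) → ThreeOnesOrClass w ⇔ (w ⊨ φ)
ThreeOnesOrClass⇔φ w = ⇔-sym (⇔-trans (sat-threeOnes w ⊎-⇔ ¬-cong-⇔ (sat-configuration w))
                       (configuration-free⇔onesOn (threeOnes? w) (length w)))
  where open Bits (bit w)

ThreeOnesOrClass-FO-definable : ∀ {k} → FO-definable (ThreeOnesOrClass {k})
ThreeOnesOrClass-FO-definable = φ , ThreeOnesOrClass⇔φ

-- The positive Ehrenfeucht–Fraïssé game

depth : ∀ {K n} → Formula K n → ℕ
depth (φ ∧ ψ) = depth φ ⊔ depth ψ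
depth (φ ∨ ψ) = depth φ ⊔ depth ψ
depth (¬' φ)  = depth φ
depth (ex φ)  = suc (depth φ)
depth (all φ) = suc (depth φ)
depth _       = zero

module PositiveGame {K : ℕ} (u v : Word K) where

  record AtomsTransfer {n} (ρ : Fin n → Pos u) (σ : Fin n → Pos v) : Set where
    field
      letter-⊆    : ∀ i → lookup u (ρ i) ⊆ lookup v (σ i)
      ≤-mono      : ∀ i j → ρ i ≤ᶠ ρ j → σ i ≤ᶠ σ j
      ≤-reflect   : ∀ i j → σ i ≤ᶠ σ j → ρ i ≤ᶠ ρ j
      suc-mono    : ∀ i j → toℕ (ρ j) ≡ suc (toℕ (ρ i)) → toℕ (σ j) ≡ suc (toℕ (σ i))
      suc-reflect : ∀ i j → toℕ (σ j) ≡ suc (toℕ (σ i)) → toℕ (ρ j) ≡ suc (toℕ (ρ i))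

    <-mono : ∀ i j → ρ i <ᶠ ρ j → σ i <ᶠ σ j
    <-mono i j ρi<ρj = ≰⇒> λ σj≤σi → <⇒≱ ρi<ρj (≤-reflect j i σj≤σi)

    ≡-mono : ∀ i j → ρ i ≡ ρ j → σ i ≡ σ j
    ≡-mono i j ρi≡ρj = Fin.≤-antisym (≤-mono i j (Fin.≤-reflexive ρi≡ρj)) (≤-mono j i (Fin.≤-reflexive (sym ρi≡ρj)))

    ≢-mono : ∀ i j → ρ i ≢ ρ j → σ i ≢ σ j
    ≢-mono i j ρi≢ρj σi≡σj = ρi≢ρj (Fin.≤-antisym (≤-reflect i j (Fin.≤-reflexive σi≡σj)) (≤-reflect j i (Fin.≤-reflexive (sym σi≡σj))))

  open AtomsTransfer

  Strategy : ℕ → ∀ {n} → (Fin n → Pos u) → (Fin n → Pos v) → Set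
  Strategy zero    ρ σ = AtomsTransfer ρ σ
  Strategy (suc d) ρ σ = AtomsTransfer ρ σ ×
    (∀ p → Σ[ q ∈ Pos v ] Strategy d (extend u p ρ) (extend v q σ)) ×
    (∀ q → Σ[ p ∈ Pos u ] Strategy d (extend u p ρ) (extend v q σ))

  strategy-atoms : ∀ d {n} {ρ : Fin n → Pos u} {σ} → Strategy d ρ σ → AtomsTransfer ρ σ
  strategy-atoms zero    atoms       = atoms
  strategy-atoms (suc d) (atoms , _) = atoms

  positive-transfer : ∀ {n} {χ : Formula K n} → Positive χ → ∀ d → depth χ ≤ d →
    ∀ {ρ σ} → Strategy d ρ σ → Sat u ρ χ → Sat v σ χ
  positive-transfer tt          d _ _ s   = s
  positive-transfer ff          d _ _ ()
  positive-transfer (pred a x)  d _ S s   = letter-⊆ (strategy-atoms d S) x s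
  positive-transfer (lt x y)    d _ S s   = <-mono (strategy-atoms d S) x y s
  positive-transfer (le x y)    d _ S s   = ≤-mono (strategy-atoms d S) x y s
  positive-transfer (eq x y)    d _ S s   = ≡-mono (strategy-atoms d S) x y s
  positive-transfer (neq x y)   d _ S s   = ≢-mono (strategy-atoms d S) x y s
  positive-transfer (succ x y)  d _ S s   = suc-mono (strategy-atoms d S) x y s
  positive-transfer (nsucc x y) d _ S s e = s (suc-reflect (strategy-atoms d S) x y e)
  positive-transfer (_∧_ {φ = φ} {ψ} +φ +ψ) d φ∧ψ≤d S (sφ , sψ) =
    positive-transfer +φ d (m⊔n≤o⇒m≤o (depth φ) (depth ψ) φ∧ψ≤d) S sφ ,
    positive-transfer +ψ d (m⊔n≤o⇒n≤o (depth φ) (depth ψ) φ∧ψ≤d) S sψ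
  positive-transfer (_∨_ {φ = φ} {ψ} +φ +ψ) d φ∨ψ≤d S (inj₁ sφ) =
    inj₁ (positive-transfer +φ d (m⊔n≤o⇒m≤o (depth φ) (depth ψ) φ∨ψ≤d) S sφ)
  positive-transfer (_∨_ {φ = φ} {ψ} +φ +ψ) d φ∨ψ≤d S (inj₂ sψ) =
    inj₂ (positive-transfer +ψ d (m⊔n≤o⇒n≤o (depth φ) (depth ψ) φ∨ψ≤d) S sψ)
  positive-transfer (ex +φ)  (suc d) (s≤s φ≤d) (_ , forth , _) (p , s) =
    let q , S' = forth p in q , positive-transfer +φ d φ≤d S' s
  positive-transfer (all +φ) (suc d) (s≤s φ≤d) (_ , _ , back) s q =
    let p , S' = back q in positive-transfer +φ d φ≤d S' (s p)

-- Inserting a letter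

window-width : ℕ → ℕ → ℕ
window-width d zero    = suc d
window-width d (suc j) = suc (window-width d j + window-width d j)

d<window-width : ∀ d j → d < window-width d j
d<window-width d zero    = ≤-refl
d<window-width d (suc j) = ≤-trans (d<window-width d j) (≤-trans (m≤m+n _ _) (n≤1+n _))

module Insertion {K : ℕ} (u v : Word K) (d : ℕ) (|v|≡ : length v ≡ suc (length u))
  (same-⊆    : ∀ p q → toℕ q ≡ toℕ p → toℕ p + d < length u → lookup u p ⊆ lookup v q)
  (shifted-⊆ : ∀ p q → toℕ q ≡ suc (toℕ p) → d ≤ toℕ p → lookup u p ⊆ lookup v q) where

  open PositiveGame u v

  -- A pebble left of the window [l , r) sits on the same position of v, one right of it on the next one.
  Side : ℕ → ℕ → ℕ → ℕ → Set
  Side l r x y = (x < l × y ≡ x) ⊎ (r ≤ x × y ≡ suc x)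

  module _ {l r : ℕ} (l<r : l < r) where

    side-≤ : ∀ {x y x' y'} → Side l r x y → Side l r x' y' → x ≤ x' → y ≤ y'
    side-≤ (inj₁ (_ , refl))   (inj₁ (_ , refl))    x≤x' = x≤x'
    side-≤ (inj₁ (_ , refl))   (inj₂ (_ , refl))    x≤x' = m≤n⇒m≤1+n x≤x'
    side-≤ (inj₂ (r≤x , refl)) (inj₁ (x'<l , refl)) x≤x' = ⊥-elim (<⇒≱ (<-trans x'<l l<r) (≤-trans r≤x x≤x'))
    side-≤ (inj₂ (_ , refl))   (inj₂ (_ , refl))    x≤x' = s≤s x≤x'

    side-≤⁻ : ∀ {x y x' y'} → Side l r x y → Side l r x' y' → y ≤ y' → x ≤ x'
    side-≤⁻ (inj₁ (_ , refl))   (inj₁ (_ , refl))    y≤y' = y≤y'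
    side-≤⁻ (inj₁ (x<l , refl)) (inj₂ (r≤x' , refl)) _    = <⇒≤ (<-trans x<l (<-≤-trans l<r r≤x'))
    side-≤⁻ (inj₂ (_ , refl))   (inj₁ (_ , refl))    y≤y' = ≤-trans (n≤1+n _) y≤y'
    side-≤⁻ (inj₂ (_ , refl))   (inj₂ (_ , refl))    y≤y' = s≤s⁻¹ y≤y'

    side-suc : ∀ {x y x' y'} → Side l r x y → Side l r x' y' → x' ≡ suc x → y' ≡ suc y
    side-suc (inj₁ (_ , refl))   (inj₁ (_ , refl))    e    = e
    side-suc (inj₁ (x<l , refl)) (inj₂ (r≤x' , refl)) refl = ⊥-elim (<⇒≱ l<r (≤-trans r≤x' x<l))
    side-suc (inj₂ (r≤x , refl)) (inj₁ (x'<l , refl)) refl = ⊥-elim (<⇒≱ (<-trans x'<l l<r) (≤-trans r≤x (n≤1+n _)))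
    side-suc (inj₂ (_ , refl))   (inj₂ (_ , refl))    e    = cong suc e

    side-suc⁻ : ∀ {x y x' y'} → Side l r x y → Side l r x' y' → y' ≡ suc y → x' ≡ suc x
    side-suc⁻ (inj₁ (_ , refl))   (inj₁ (_ , refl))    e    = e
    side-suc⁻ (inj₁ (x<l , refl)) (inj₂ (r≤x' , refl)) e    =
      ⊥-elim (<⇒≱ (<-trans x<l l<r) (subst (r ≤_) (suc-injective e) r≤x'))
    side-suc⁻ (inj₂ (r≤x , refl)) (inj₁ (x'<l , refl)) refl =
      ⊥-elim (<⇒≱ (<-trans x'<l l<r) (≤-trans r≤x (≤-trans (n≤1+n _) (n≤1+n _))))
    side-suc⁻ (inj₂ (_ , refl))   (inj₂ (_ , refl))    e    = suc-injective e

  record Window (w : ℕ) {n} (ρ : Fin n → Pos u) (σ : Fin n → Pos v) : Set where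
    field
      l r   : ℕ
      wide  : l + w ≤ r
      r≤|u| : r ≤ length u
      sides : ∀ i → Side l r (toℕ (ρ i)) (toℕ (σ i))

  window-atoms : ∀ {w n} {ρ : Fin n → Pos u} {σ} → d < w → Window w ρ σ → AtomsTransfer ρ σ
  window-atoms {w} {ρ = ρ} {σ} d<w W = record
    { letter-⊆    = letter-⊆
    ; ≤-mono      = λ i j → side-≤ l<r (sides i) (sides j)
    ; ≤-reflect   = λ i j → side-≤⁻ l<r (sides i) (sides j)
    ; suc-mono    = λ i j → side-suc l<r (sides i) (sides j)
    ; suc-reflect = λ i j → side-suc⁻ l<r (sides i) (sides j)
    }
    where
      open Window W
      l<r : l < r
      l<r = <-≤-trans (m<m+n l (≤-<-trans z≤n d<w)) wide

      letter-⊆ : ∀ i → lookup u (ρ i) ⊆ lookup v (σ i)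
      letter-⊆ i with sides i
      ... | inj₁ (x<l , y≡x) = same-⊆ (ρ i) (σ i) y≡x
        (<-≤-trans (+-monoˡ-< d x<l) (≤-trans (+-monoʳ-≤ l (<⇒≤ d<w)) (≤-trans wide r≤|u|)))
      ... | inj₂ (r≤x , y≡x+1) = shifted-⊆ (ρ i) (σ i) y≡x+1
        (≤-trans (<⇒≤ d<w) (≤-trans (m≤n+m w l) (≤-trans wide r≤x)))

  module _ {w w' n} {ρ : Fin n → Pos u} {σ : Fin n → Pos v} (w'≤w : w' ≤ w) (W : Window w ρ σ) where
    open Window W

    window-left : ∀ p q → toℕ q ≡ toℕ p → suc (toℕ p) + w' ≤ r → Window w' (extend u p ρ) (extend v q σ)
    window-left p q q≡p room = record
      { l = l ⊔ suc (toℕ p) ; r = r ; r≤|u| = r≤|u|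
      ; wide  = subst (_≤ r) (sym (+-distribʳ-⊔ w' l (suc (toℕ p)))) (⊔-lub (≤-trans (+-monoʳ-≤ l w'≤w) wide) room)
      ; sides = sides′
      }
      where
        sides′ : ∀ i → Side (l ⊔ suc (toℕ p)) r (toℕ (extend u p ρ i)) (toℕ (extend v q σ i))
        sides′ fzero    = inj₁ (m≤n⊔m l (suc (toℕ p)) , q≡p)
        sides′ (fsuc i) with sides i
        ... | inj₁ (x<l , y≡x) = inj₁ (<-≤-trans x<l (m≤m⊔n l _) , y≡x)
        ... | inj₂ right       = inj₂ right

    window-right : ∀ p q → toℕ q ≡ suc (toℕ p) → l + w' ≤ toℕ p → Window w' (extend u p ρ) (extend v q σ)
    window-right p q q≡p+1 room = record
      { l = l ; r = r ⊓ toℕ p ; r≤|u| = ≤-trans (m⊓n≤m r _) r≤|u|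
      ; wide  = ⊓-glb (≤-trans (+-monoʳ-≤ l w'≤w) wide) room
      ; sides = sides′
      }
      where
        sides′ : ∀ i → Side l (r ⊓ toℕ p) (toℕ (extend u p ρ i)) (toℕ (extend v q σ i))
        sides′ fzero    = inj₂ (m⊓n≤n r (toℕ p) , q≡p+1)
        sides′ (fsuc i) with sides i
        ... | inj₁ left             = inj₁ left
        ... | inj₂ (r≤x , y≡x+1) = inj₂ (≤-trans (m⊓n≤m r _) r≤x , y≡x+1)

  left-or-right : ∀ {w w' l r} → suc (w' + w') ≤ w → l + w ≤ r → ∀ x → suc x + w' ≤ r ⊎ l + w' < x
  left-or-right {w} {w'} {l} {r} 2w'<w wide x with suc x + w' ≤? r
  ... | yes room   = inj₁ room
  ... | no no-room = inj₂ (+-cancelʳ-≤ w' _ _ (begin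
    suc (l + w') + w'   ≡⟨ cong suc (+-assoc l w' w') ⟩
    suc (l + (w' + w')) ≡⟨ +-suc l (w' + w') ⟨
    l + suc (w' + w')   ≤⟨ +-monoʳ-≤ l 2w'<w ⟩
    l + w               ≤⟨ wide ⟩
    r                   ≤⟨ s≤s⁻¹ (≰⇒> no-room) ⟩
    x + w'              ∎))
    where open ≤-Reasoning

  module _ {w w' n} {ρ : Fin n → Pos u} {σ : Fin n → Pos v} (2w'<w : suc (w' + w') ≤ w) (W : Window w ρ σ) where
    open Window W

    w'≤w : w' ≤ w
    w'≤w = ≤-trans (m≤m+n w' w') (≤-trans (n≤1+n _) 2w'<w)

    window-forth : ∀ p → Σ[ q ∈ Pos v ] Window w' (extend u p ρ) (extend v q σ)
    window-forth p with left-or-right 2w'<w wide (toℕ p)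
    ... | inj₁ room =
      let q , q≡p = position {xs = v} (subst (toℕ p <_) (sym |v|≡) (m<n⇒m<1+n (toℕ<n p)))
      in q , window-left w'≤w W p q q≡p room
    ... | inj₂ far =
      let q , q≡p+1 = position {xs = v} (subst (suc (toℕ p) <_) (sym |v|≡) (s≤s (toℕ<n p)))
      in q , window-right w'≤w W p q q≡p+1 (<⇒≤ far)

    window-back : ∀ q → Σ[ p ∈ Pos u ] Window w' (extend u p ρ) (extend v q σ)
    window-back q with left-or-right 2w'<w wide (toℕ q)
    ... | inj₁ room =
      let p , p≡q = position {xs = u} (≤-trans (m≤m+n _ w') (≤-trans room r≤|u|))
      in p , window-left w'≤w W p q (sym p≡q) (subst (λ y → suc y + w' ≤ r) (sym p≡q) room)
    ... | inj₂ far = back-right (toℕ q) refl far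
      where
        back-right : ∀ y → toℕ q ≡ y → l + w' < y → Σ[ p ∈ Pos u ] Window w' (extend u p ρ) (extend v q σ)
        back-right (suc x) q≡ far =
          let p , p≡x = position {xs = u} (s≤s⁻¹ (subst (suc x <_) |v|≡ (subst (_< length v) q≡ (toℕ<n q))))
          in p , window-right w'≤w W p q (trans q≡ (cong suc (sym p≡x))) (subst (l + w' ≤_) (sym p≡x) (s≤s⁻¹ far))

  width : ℕ → ℕ
  width = window-width d

  d<width : ∀ j → d < width j
  d<width = d<window-width d

  window⇒strategy : ∀ j {n} {ρ : Fin n → Pos u} {σ} → Window (width j) ρ σ → Strategy j ρ σ
  window⇒strategy zero    W = window-atoms (d<width zero) W
  window⇒strategy (suc j) W =
    window-atoms (d<width (suc j)) W ,
    (λ p → let q , W′ = window-forth ≤-refl W p in q , window⇒strategy j W′) ,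
    (λ q → let p , W′ = window-back ≤-refl W q in p , window⇒strategy j W′)

  insertion-transfer : ∀ j → width j ≤ length u → ∀ {χ : Sentence K} → Positive χ → depth χ ≤ j → u ⊨ χ → v ⊨ χ
  insertion-transfer j room +χ χ≤j = positive-transfer +χ j χ≤j (window⇒strategy j initial)
    where
      initial : Window (width j) (empty u) (empty v)
      initial = record { l = 0 ; r = width j ; wide = ≤-refl ; r≤|u| = room ; sides = λ () }

-- The witnesses

letter : ∀ {k} → Bool → Letter (suc k)
letter true  = full
letter false = ∅

word : ∀ {k} → (ℕ → Bool) → ℕ → Word (suc k)
word g n = applyUpTo (letter ∘ g) n

module _ {k : ℕ} where

  letter-⊆ : ∀ {b₁ b₂} → (b₁ ≡ true → b₂ ≡ true) → letter {k} b₁ ⊆ letter b₂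
  letter-⊆ {false} _       a∈ = ⊥-elim (∉⊥ a∈)
  letter-⊆ {true}  b₂≡true a∈ rewrite b₂≡true refl = a∈

  does-letter : ∀ b → does (fzero ∈? letter {k} b) ≡ b
  does-letter true  = dec-true (fzero ∈? full) (∈⊤ {x = fzero {k}})
  does-letter false = dec-false (fzero ∈? ∅) (∉⊥ {x = fzero {k}})

  length-word : ∀ g n → length (word {k} g n) ≡ n
  length-word g = length-applyUpTo (letter ∘ g)

  lookup-word : ∀ g n (p : Pos (word {k} g n)) → lookup (word g n) p ≡ letter (g (toℕ p))
  lookup-word g = lookup-applyUpTo (letter ∘ g)

  word-⊆ : ∀ g g' {n n'} (p : Pos (word {k} g n)) (q : Pos (word {k} g' n')) →
           (g (toℕ p) ≡ true → g' (toℕ q) ≡ true) → lookup (word g n) p ⊆ lookup (word g' n') q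
  word-⊆ g g' {n} {n'} p q one⇒one =
    subst₂ _⊆_ (sym (lookup-word g n p)) (sym (lookup-word g' n' q)) (letter-⊆ one⇒one)

  bit-word : ∀ g n {x} → x < length (word {k} g n) → bit (word g n) x ≡ g x
  bit-word g n x<n with position {xs = word {k} g n} x<n
  ... | p , refl = trans (bit-lookup (word g n) p) (trans (cong (λ a → does (fzero ∈? a)) (lookup-word g n p)) (does-letter _))

  bit-word-one : ∀ g n x → bit (word {k} g n) x ≡ true → g x ≡ true
  bit-word-one g n x one = trans (sym (bit-word g n (bit⇒< (word g n) x one))) one

isR₀ : Residue → Bool
isR₀ r₀ = true
isR₀ _  = false

isR₀-true : ∀ {r} → isR₀ r ≡ true → r ≡ r₀
isR₀-true {r₀} _ = refl

residue-*3 : ∀ n → residue (n * 3) ≡ r₀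
residue-*3 zero    = refl
residue-*3 (suc n) = trans (next³ _) (residue-*3 n)

uBit : ℕ → Bool
uBit x = isR₀ (residue x)

vBit : ℕ → ℕ → Bool
vBit e y = byResidue (residue y)
  where
    byResidue : Residue → Bool
    byResidue r₀ = not (does (y ≟ e))
    byResidue r₁ = not (does (y ≟ 1))
    byResidue r₂ = false

vBit-r₀ : ∀ e y → residue y ≡ r₀ → y ≢ e → vBit e y ≡ true
vBit-r₀ e y y≡r₀ y≢e rewrite y≡r₀ = cong not (dec-false (y ≟ e) y≢e)

vBit-r₁ : ∀ e y → residue y ≡ r₁ → y ≢ 1 → vBit e y ≡ true
vBit-r₁ e y y≡r₁ y≢1 rewrite y≡r₁ = cong not (dec-false (y ≟ 1) y≢1)

vBit-r₂ : ∀ e y → residue y ≡ r₂ → vBit e y ≡ false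
vBit-r₂ e y y≡r₂ rewrite y≡r₂ = refl

vBit-last : ∀ e → residue e ≡ r₀ → vBit e e ≡ false
vBit-last e e≡r₀ rewrite e≡r₀ = cong not (dec-true (e ≟ e) refl)

module Witness (k m : ℕ) where

  e : ℕ
  e = suc m * 3

  u : Word (suc k)
  u = word uBit e

  v : Word (suc k)
  v = word (vBit e) (suc e)

  |v|≡ : length v ≡ suc (length u)
  |v|≡ = trans (length-word (vBit e) (suc e)) (cong suc (sym (length-word uBit e)))

  u-accepted : ThreeOnesOrClass u
  u-accepted = inj₂ (r₀ , λ x x<|u| x≡r₀ → trans (bit-word uBit e x<|u|) (cong isR₀ x≡r₀))

  class-with-zero : ∀ {r} y → y < suc e → residue y ≡ r → vBit e y ≡ false → ¬ Bits.OnesOn (bit v) (length v) r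
  class-with-zero y y<e+1 y≡r off ones = bit-clash (trans (sym (bit-word (vBit e) (suc e) y<|v|)) (ones y y<|v| y≡r)) off
    where
      y<|v| : y < length v
      y<|v| = subst (y <_) (sym (length-word (vBit e) (suc e))) y<e+1

  v-rejected : ¬ ThreeOnesOrClass v
  v-rejected (inj₁ (x , one₀ , one₁ , one₂)) with next-orbit (residue x) r₂
  ... | inj₁ r₂≡        = bit-clash (bit-word-one (vBit e) (suc e) x one₀) (vBit-r₂ e x (sym r₂≡))
  ... | inj₂ (inj₁ r₂≡) = bit-clash (bit-word-one (vBit e) (suc e) (suc x) one₁) (vBit-r₂ e (suc x) (sym r₂≡))
  ... | inj₂ (inj₂ r₂≡) = bit-clash (bit-word-one (vBit e) (suc e) (suc (suc x)) one₂) (vBit-r₂ e (suc (suc x)) (sym r₂≡))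
  v-rejected (inj₂ (r₀ , ones)) = class-with-zero e (n<1+n e) (residue-*3 (suc m)) (vBit-last e (residue-*3 (suc m))) ones
  v-rejected (inj₂ (r₁ , ones)) = class-with-zero 1 (s≤s (s≤s z≤n)) refl refl ones
  v-rejected (inj₂ (r₂ , ones)) = class-with-zero 2 (s≤s (s≤s (s≤s z≤n))) refl refl ones

  same-⊆ : ∀ p q → toℕ q ≡ toℕ p → toℕ p + 1 < length u → lookup u p ⊆ lookup v q
  same-⊆ p q q≡p p+1<|u| = word-⊆ uBit (vBit e) {e} {suc e} p q one⇒one
    where
      p<e : toℕ p < e
      p<e = <-≤-trans (m<m+n (toℕ p) (s≤s z≤n)) (≤-trans (<⇒≤ p+1<|u|) (≤-reflexive (length-word uBit e)))

      one⇒one : uBit (toℕ p) ≡ true → vBit e (toℕ q) ≡ true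
      one⇒one p∈r₀ rewrite q≡p = vBit-r₀ e (toℕ p) (isR₀-true p∈r₀) λ p≡e → <⇒≱ p<e (≤-reflexive (sym p≡e))

  shifted-⊆ : ∀ p q → toℕ q ≡ suc (toℕ p) → 1 ≤ toℕ p → lookup u p ⊆ lookup v q
  shifted-⊆ p q q≡p+1 1≤p = word-⊆ uBit (vBit e) {e} {suc e} p q one⇒one
    where
      one⇒one : uBit (toℕ p) ≡ true → vBit e (toℕ q) ≡ true
      one⇒one p∈r₀ rewrite q≡p+1 =
        vBit-r₁ e (suc (toℕ p)) (cong next (isR₀-true p∈r₀)) λ p+1≡1 → <⇒≱ 1≤p (≤-reflexive (suc-injective p+1≡1))

ThreeOnesOrClass-not-FO⁺-definable : ∀ {k} → ¬ FO⁺-definable (ThreeOnesOrClass {k})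
ThreeOnesOrClass-not-FO⁺-definable {k} (χ , +χ , L⇔χ) =
  v-rejected (Equivalence.from (L⇔χ v) (insertion-transfer j room +χ ≤-refl (Equivalence.to (L⇔χ u) u-accepted)))
  where
    j : ℕ
    j = depth χ
    open Witness k (window-width 1 j)
    open Insertion u v 1 |v|≡ same-⊆ shifted-⊆
    room : width j ≤ length u
    room = ≤-trans (n≤1+n _) (≤-trans (m≤m*n (suc (window-width 1 j)) 3) (≤-reflexive (sym (length-word uBit e))))

proposition35 : (k : ℕ) → 1 ≤ k →
    Σ[ L ∈ Language k ] (Monotone L × FO-definable L × ¬ FO⁺-definable L)
proposition35 zero    ()
proposition35 (suc k) _ =
  ThreeOnesOrClass , ThreeOnesOrClass-monotone , ThreeOnesOrClass-FO-definable , ThreeOnesOrClass-not-FO⁺-definable
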